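{- Let $G=(U,V,E)$ be a bipartite graph with $|U|=|V|=N$, and run the simplified auction algorithm on $G$. Let $i\geq0$ be such that $M(i)$ is not a maximum matching, let $l$ be an integer, and let $u_0\in U$ be free with respect to $M(i)$ with $n_{u_0}\subseteq D_l(i)$. Let $u_1\in U$ be the end point of an alternating path (with respect to $M(i)$) of length $2$ starting at $u_0$. Then for every $v\in n_{u_1}$, $v\notin D_{l-2}(i)\setminus D_{l-1}(i)$.
   Context: For a vertex $w$, $n_w$ denotes its set of neighbours. A vertex is free with respect to a matching $M$ if no edge of $M$ is incident to it. A path of length $l$ is a sequence of $l+1$ vertices $v_1,\dots,v_{l+1}$ with $\{v_k,v_{k+1}\}\in E$ for all $k$; it is alternating with respect to $M$ if $(v_k,v_{k+1})\notin M$ for odd $k$ and $(v_k,v_{k+1})\in M$ for even $k$. The simplified auction algorithm maintains a matching $M\subseteq E$ and integer values $h_v$, $v\in V$: initially $M=\emptyset$, $h_v=0$. While $|M|<N$ and $\sum_{v\in V}h_v<N(N-1)$, it performs one iteration: choose (arbitrarily) a free vertex $u\in U$; choose $j\in\arg\min_{v\in n_u}h_v$ (ties arbitrary); if some $u_{old}$ has $(u_{old},j)\in M$, remove that edge; add $(u,j)$ to $M$; set $h_j\leftarrow h_j+1$. $M(i)$ and $h_v(i)$ denote the matching and values after $i$ iterations, and $D_l(i)=\{v\in V:h_v(i)\geq l\}$. -}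

module Defs where

open import Data.Nat using (ℕ; zero; suc; _+_; _*_; _∸_; _≤_; _<_)
open import Data.Fin using (Fin; _≟_)
open import Data.Bool using (Bool; true; false; if_then_else_)
open import Data.Product using (Σ; _×_; _,_)
open import Data.Integer using (ℤ; +_) renaming (_≤_ to _≤ℤ_)
open import Data.List using (List; map)
open import Data.Nat.ListAction using (sum)
open import Data.List.Base using (allFin)
open import Relation.Nullary using (¬_)
open import Relation.Nullary.Decidable using (⌊_⌋)
open import Relation.Binary.PropositionalEquality using (_≡_)

-- A bipartite graph G = (U, V, E) with |U| = |V| = N:
-- U = Fin N, V = Fin N (two disjoint copies), E u v ≡ true iff {u,v} ∈ E.
Graph : ℕ → Set
Graph N = Fin N → Fin N → Bool

EdgeSet : ℕ → Set
EdgeSet N = Fin N → Fin N → Bool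

ΣFin : (N : ℕ) → (Fin N → ℕ) → ℕ
ΣFin N f = sum (map f (allFin N))

card : {N : ℕ} → EdgeSet N → ℕ
card {N} M = ΣFin N (λ u → ΣFin N (λ v → if M u v then 1 else 0))

IsMatching : {N : ℕ} → Graph N → EdgeSet N → Set
IsMatching {N} E M =
  ((u v : Fin N) → M u v ≡ true → E u v ≡ true) ×
  ((u : Fin N) (v v' : Fin N) → M u v ≡ true → M u v' ≡ true → v ≡ v') ×
  ((u u' : Fin N) (v : Fin N) → M u v ≡ true → M u' v ≡ true → u ≡ u')

IsMaximumMatching : {N : ℕ} → Graph N → EdgeSet N → Set
IsMaximumMatching {N} E M =
  IsMatching E M × ((M' : EdgeSet N) → IsMatching E M' → card M' ≤ card M)

FreeU : {N : ℕ} → EdgeSet N → Fin N → Set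
FreeU {N} M u = (v : Fin N) → M u v ≡ false

record State (N : ℕ) : Set where
  constructor ⟨_,_⟩
  field
    M : EdgeSet N
    h : Fin N → ℕ
open State public

initial : (N : ℕ) → State N
initial N = ⟨ (λ _ _ → false) , (λ _ → 0) ⟩

-- One iteration of the simplified auction algorithm (nondeterministic: the free
-- vertex u and the minimiser j are arbitrary), guarded by the while-condition.
data Step {N : ℕ} (E : Graph N) : State N → State N → Set where
  step : (s : State N) (u j : Fin N) →
         card (M s) < N →
         ΣFin N (h s) < N * (N ∸ 1) →
         FreeU (M s) u →
         E u j ≡ true →
         ((v : Fin N) → E u v ≡ true → h s j ≤ h s v) →
         Step E s
           ⟨ (λ u' v' → if ⌊ v' ≟ j ⌋ then ⌊ u' ≟ u ⌋ else M s u' v')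
           , (λ v' → if ⌊ v' ≟ j ⌋ then suc (h s v') else h s v') ⟩

data AfterIter {N : ℕ} (E : Graph N) : ℕ → State N → Set where
  start : AfterIter E 0 (initial N)
  next  : ∀ {i s s'} → AfterIter E i s → Step E s s' → AfterIter E (suc i) s'

InD : {N : ℕ} → State N → ℤ → Fin N → Set
InD s l v = l ≤ℤ + (h s v)

-- Each time j is assigned to u it is a minimiser of h over n_u, and h_j then grows by one, while
-- the other values of n_u can only grow.  Hence along the whole run a matched edge (u, v₁) satisfies
-- h_{v₁} ≤ h_v + 1 for every v ∈ n_u.  If the alternating path u₀ v₁ u₁ has n_{u₀} ⊆ D_l, then
-- h_{v₁} ≥ l, so every v ∈ n_{u₁} has h_v ≥ l - 1, i.e. v ∈ D_{l-1}.
module Submission where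

open import Defs
open import Data.Nat using (ℕ; suc; _≤_; s≤s)
open import Data.Nat.Properties using (≤-trans; ≤-refl; n≤1+n)
open import Data.Fin using (Fin; _≟_)
open import Data.Bool using (true; false)
open import Data.Product using (_×_; _,_)
open import Data.Integer using (ℤ; _-_; -_; +_; +≤+) renaming (_≤_ to _≤ℤ_)
import Data.Integer.Properties as ℤ
open import Relation.Nullary using (¬_; yes; no)
open import Relation.Binary.PropositionalEquality using (_≡_; refl)

MatchedWithinOneOfMin : {N : ℕ} → Graph N → State N → Set
MatchedWithinOneOfMin {N} E s =
  (u v₁ v : Fin N) → M s u v₁ ≡ true → E u v ≡ true → h s v₁ ≤ suc (h s v)

step-h-mono : {N : ℕ} {E : Graph N} {s s' : State N} → Step E s s' →
              (v : Fin N) → h s v ≤ h s' v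
step-h-mono (step s u j _ _ _ _ _) v with v ≟ j
... | yes _ = n≤1+n _
... | no  _ = ≤-refl

step-preserves-matchedWithinOneOfMin :
  {N : ℕ} {E : Graph N} {s s' : State N} → Step E s s' →
  MatchedWithinOneOfMin E s → MatchedWithinOneOfMin E s'
step-preserves-matchedWithinOneOfMin st@(step s u j _ _ _ _ j-min) inv u' v₁ v m e
  with v₁ ≟ j
... | no _ = ≤-trans (inv u' v₁ v m e) (s≤s (step-h-mono st v))
... | yes refl with u' ≟ u
...   | yes refl = s≤s (≤-trans (j-min v e) (step-h-mono st v))
step-preserves-matchedWithinOneOfMin (step s u j _ _ _ _ _) inv u' v₁ v () e
  | yes refl | no _

afterIter⇒matchedWithinOneOfMin : {N : ℕ} {E : Graph N} {i : ℕ} {s : State N} →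
                                  AfterIter E i s → MatchedWithinOneOfMin E s
afterIter⇒matchedWithinOneOfMin start u v₁ v ()
afterIter⇒matchedWithinOneOfMin (next run st) =
  step-preserves-matchedWithinOneOfMin st (afterIter⇒matchedWithinOneOfMin run)

l≤1+n⇒l-1≤n : (l : ℤ) (n : ℕ) → l ≤ℤ + suc n → l - + 1 ≤ℤ + n
l≤1+n⇒l-1≤n l n l≤1+n = ℤ.+-monoˡ-≤ (- + 1) l≤1+n

mainTheorem4 : (N : ℕ) (E : Graph N) (i : ℕ) (s : State N) →
    AfterIter E i s →
    ¬ IsMaximumMatching E (M s) →
    (l : ℤ) (u₀ : Fin N) →
    FreeU (M s) u₀ →
    ((v : Fin N) → E u₀ v ≡ true → InD s l v) →
    (v₁ u₁ : Fin N) →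
    E u₀ v₁ ≡ true → M s u₀ v₁ ≡ false → M s u₁ v₁ ≡ true →
    (v : Fin N) → E u₁ v ≡ true →
    ¬ (InD s (l - + 2) v × ¬ InD s (l - + 1) v)
mainTheorem4 N E i s run _ l u₀ _ nu₀⊆Dl v₁ u₁ Eu₀v₁ _ Mu₁v₁ v Eu₁v (_ , v∉Dl-1) =
  v∉Dl-1 (l≤1+n⇒l-1≤n l (h s v) (ℤ.≤-trans (nu₀⊆Dl v₁ Eu₀v₁) (+≤+ v₁-near-min)))
  where
  v₁-near-min : h s v₁ ≤ suc (h s v)
  v₁-near-min = afterIter⇒matchedWithinOneOfMin run u₁ v₁ v Mu₁v₁ Eu₁v
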